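{- Let $G$ be a formula and $\tau$ a $\mathbf{GBU}(G)$-sequent (of the form $\Psi\Rightarrow_g A$ or $\Psi\rightarrow_g A$). If $\tau$ is derivable in $\mathbf{GBU}(G)$, then $\tau$ is valid, i.e. the formula $(\bigwedge\Psi)\supset A$ is valid in intuitionistic propositional logic (with $\bigwedge\emptyset=\bot\supset\bot$).
   Context: Formulas are built from a countably infinite set of propositional variables and $\bot$ using $\land,\lor,\supset$. For a formula $G$, $\mathrm{Sl}(G)$ and $\mathrm{Sr}(G)$ are the smallest subsets of the subformulas of $G$ with: $G\in\mathrm{Sr}(G)$; $A\land B$ or $A\lor B$ in $\mathrm{Sl}(G)$ (resp. $\mathrm{Sr}(G)$) implies $A,B$ in $\mathrm{Sl}(G)$ (resp. $\mathrm{Sr}(G)$); $A\supset B\in\mathrm{Sl}(G)$ implies $B\in\mathrm{Sl}(G)$, $A\in\mathrm{Sr}(G)$; $A\supset B\in\mathrm{Sr}(G)$ implies $B\in\mathrm{Sr}(G)$, $A\in\mathrm{Sl}(G)$. $\mathrm{Cl}(\Gamma)$ is the smallest set containing $\Gamma$ such that if $X,Y\in\mathrm{Cl}(\Gamma)$ and $A$ is any formula then $X\land Y,A\lor X,X\lor A,A\supset X\in\mathrm{Cl}(\Gamma)$. Commas denote union. $\mathbf{GBU}(G)$: sequents regular $\Psi\Rightarrow_g A$ and irregular $\Psi\rightarrow_g A$ with $\Psi\subseteq\mathrm{Sl}(G)$, $A\in\mathrm{Sr}(G)$ (all sequents in rules satisfy this). Rules ($k\in\{1,2\}$): axioms $A,\Psi\Rightarrow_g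 A$, $\bot,\Psi\Rightarrow_g C$, $A,\Psi\rightarrow_g A$; $L\land$: $A,B,\Psi\Rightarrow_g C/A\land B,\Psi\Rightarrow_g C$; $R\land$: $\Psi\Rightarrow_g A$, $\Psi\Rightarrow_g B/\Psi\Rightarrow_g A\land B$ and likewise with $\rightarrow_g$ throughout; $L\lor$: $A,\Psi\Rightarrow_g C$, $B,\Psi\Rightarrow_g C/A\lor B,\Psi\Rightarrow_g C$; $R\lor_k$: $\Psi\rightarrow_g C_k/\Psi\Rightarrow_g C_1\lor C_2$ and $\Psi\rightarrow_g C_k/\Psi\rightarrow_g C_1\lor C_2$; $L\supset$: $A\supset B,\Psi\rightarrow_g A$, $B,\Psi\Rightarrow_g C/A\supset B,\Psi\Rightarrow_g C$; $\supset R_\in$: $\Psi\Rightarrow_g B/\Psi\Rightarrow_g A\supset B$ and $\Psi\rightarrow_g B/\Psi\rightarrow_g A\supset B$, if $A\in\mathrm{Cl}(\Psi)$; $\supset R_{\notin}$: $A,\Psi\Rightarrow_g B/\Psi\Rightarrow_g A\supset B$ and $A,\Psi\Rightarrow_g B/\Psi\rightarrow_g A\supset B$, if $A\notin\mathrm{Cl}(\Psi)$. -}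

module Defs where

open import Data.Nat using (ℕ)
open import Data.List using (List; []; _∷_)
open import Data.List.Membership.Propositional using (_∈_)
open import Data.List.Relation.Unary.All using (All)
open import Data.Product using (_×_)
open import Function.Bundles using (_⇔_)
open import Relation.Nullary using (¬_)

infixr 6 _∧_
infixr 5 _∨_
infixr 4 _⊃_

data Fm : Set where
  var : ℕ → Fm
  ⊥'  : Fm
  _∧_ : Fm → Fm → Fm
  _∨_ : Fm → Fm → Fm
  _⊃_ : Fm → Fm → Fm

mutual
  data Sl (G : Fm) : Fm → Set where
    sl∧₁ : ∀ {A B} → Sl G (A ∧ B) → Sl G A
    sl∧₂ : ∀ {A B} → Sl G (A ∧ B) → Sl G B
    sl∨₁ : ∀ {A B} → Sl G (A ∨ B) → Sl G A
    sl∨₂ : ∀ {A B} → Sl G (A ∨ B) → Sl G B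
    sl⊃  : ∀ {A B} → Sl G (A ⊃ B) → Sl G B
    sr⊃  : ∀ {A B} → Sr G (A ⊃ B) → Sl G A

  data Sr (G : Fm) : Fm → Set where
    sr-G : Sr G G
    sr∧₁ : ∀ {A B} → Sr G (A ∧ B) → Sr G A
    sr∧₂ : ∀ {A B} → Sr G (A ∧ B) → Sr G B
    sr∨₁ : ∀ {A B} → Sr G (A ∨ B) → Sr G A
    sr∨₂ : ∀ {A B} → Sr G (A ∨ B) → Sr G B
    sr⊃' : ∀ {A B} → Sr G (A ⊃ B) → Sr G B
    sl⊃' : ∀ {A B} → Sl G (A ⊃ B) → Sr G A

data Cl (Γ : List Fm) : Fm → Set where
  cl-base : ∀ {X} → X ∈ Γ → Cl Γ X
  cl-∧    : ∀ {X Y} → Cl Γ X → Cl Γ Y → Cl Γ (X ∧ Y)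
  cl-∨ˡ   : ∀ {X} A → Cl Γ X → Cl Γ (A ∨ X)
  cl-∨ʳ   : ∀ {X} A → Cl Γ X → Cl Γ (X ∨ A)
  cl-⊃    : ∀ {X} A → Cl Γ X → Cl Γ (A ⊃ X)

-- Finite sets of formulas are represented by lists; two lists denote
-- the same set when they have the same members.
_≈ₛ_ : List Fm → List Fm → Set
Φ ≈ₛ Ψ = ∀ X → (X ∈ Φ) ⇔ (X ∈ Ψ)

-- The two kinds of sequent arrows: regular ⇒_g and irregular →_g
data Arrow : Set where
  reg irr : Arrow

WF : Fm → List Fm → Fm → Set
WF G Ψ A = All (Sl G) Ψ × Sr G A

-- Every conclusion must be a GBU(G)-sequent.
-- Contexts are sets: the rule `set-eq` identifies lists with the same members.
data GBU (G : Fm) : Arrow → List Fm → Fm → Set where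
  set-eq : ∀ {k Φ Ψ C} → Φ ≈ₛ Ψ → WF G Ψ C → GBU G k Φ C → GBU G k Ψ C
  ax-reg : ∀ {A Ψ} → WF G (A ∷ Ψ) A → GBU G reg (A ∷ Ψ) A
  ax-⊥   : ∀ {Ψ C} → WF G (⊥' ∷ Ψ) C → GBU G reg (⊥' ∷ Ψ) C
  ax-irr : ∀ {A Ψ} → WF G (A ∷ Ψ) A → GBU G irr (A ∷ Ψ) A
  L∧     : ∀ {A B Ψ C} → WF G ((A ∧ B) ∷ Ψ) C →
           GBU G reg (A ∷ B ∷ Ψ) C → GBU G reg ((A ∧ B) ∷ Ψ) C
  R∧     : ∀ {k Ψ A B} → WF G Ψ (A ∧ B) →
           GBU G k Ψ A → GBU G k Ψ B → GBU G k Ψ (A ∧ B)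
  L∨     : ∀ {A B Ψ C} → WF G ((A ∨ B) ∷ Ψ) C →
           GBU G reg (A ∷ Ψ) C → GBU G reg (B ∷ Ψ) C → GBU G reg ((A ∨ B) ∷ Ψ) C
  R∨₁    : ∀ {k Ψ C₁ C₂} → WF G Ψ (C₁ ∨ C₂) →
           GBU G irr Ψ C₁ → GBU G k Ψ (C₁ ∨ C₂)
  R∨₂    : ∀ {k Ψ C₁ C₂} → WF G Ψ (C₁ ∨ C₂) →
           GBU G irr Ψ C₂ → GBU G k Ψ (C₁ ∨ C₂)
  L⊃     : ∀ {A B Ψ C} → WF G ((A ⊃ B) ∷ Ψ) C →
           GBU G irr ((A ⊃ B) ∷ Ψ) A → GBU G reg (B ∷ Ψ) C →
           GBU G reg ((A ⊃ B) ∷ Ψ) C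
  ⊃R∈    : ∀ {k Ψ A B} → WF G Ψ (A ⊃ B) → Cl Ψ A →
           GBU G k Ψ B → GBU G k Ψ (A ⊃ B)
  ⊃R∉    : ∀ {k Ψ A B} → WF G Ψ (A ⊃ B) → ¬ Cl Ψ A →
           GBU G reg (A ∷ Ψ) B → GBU G k Ψ (A ⊃ B)

infix 2 _⊢_
data _⊢_ : List Fm → Fm → Set where
  hyp  : ∀ {Γ A} → A ∈ Γ → Γ ⊢ A
  ⊥E   : ∀ {Γ A} → Γ ⊢ ⊥' → Γ ⊢ A
  ∧I   : ∀ {Γ A B} → Γ ⊢ A → Γ ⊢ B → Γ ⊢ A ∧ B
  ∧E₁  : ∀ {Γ A B} → Γ ⊢ A ∧ B → Γ ⊢ A
  ∧E₂  : ∀ {Γ A B} → Γ ⊢ A ∧ B → Γ ⊢ B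
  ∨I₁  : ∀ {Γ A B} → Γ ⊢ A → Γ ⊢ A ∨ B
  ∨I₂  : ∀ {Γ A B} → Γ ⊢ B → Γ ⊢ A ∨ B
  ∨E   : ∀ {Γ A B C} → Γ ⊢ A ∨ B → (A ∷ Γ) ⊢ C → (B ∷ Γ) ⊢ C → Γ ⊢ C
  ⊃I   : ∀ {Γ A B} → (A ∷ Γ) ⊢ B → Γ ⊢ A ⊃ B
  ⊃E   : ∀ {Γ A B} → Γ ⊢ A ⊃ B → Γ ⊢ A → Γ ⊢ B

Valid : Fm → Set
Valid A = [] ⊢ A

⋀ : List Fm → Fm
⋀ []       = ⊥' ⊃ ⊥'
⋀ (A ∷ []) = A
⋀ (A ∷ Ψ)  = A ∧ ⋀ Ψ

-- A GBU(G) derivation is read as an NJ derivation of its sequent: every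
-- left rule becomes a substitution of an eliminated hypothesis, every right
-- rule the matching introduction, and ⊃R∈ merely drops the now superfluous
-- discharge. The hypotheses Ψ are then recovered from ⋀ Ψ by ∧-eliminations.
module Submission where

open import Defs
open import Data.List using (List; []; _∷_)
open import Data.List.Membership.Propositional using (_∈_)
open import Data.List.Relation.Unary.Any using (here; there)
open import Relation.Binary.PropositionalEquality using (refl)
open import Function.Bundles using (Equivalence)

Renaming : List Fm → List Fm → Set
Renaming Γ Δ = ∀ {X} → X ∈ Γ → X ∈ Δ

lift-renaming : ∀ {Γ Δ A} → Renaming Γ Δ → Renaming (A ∷ Γ) (A ∷ Δ)
lift-renaming ρ (here p)  = here p
lift-renaming ρ (there p) = there (ρ p)

rename : ∀ {Γ Δ C} → Renaming Γ Δ → Γ ⊢ C → Δ ⊢ C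
rename ρ (hyp x)    = hyp (ρ x)
rename ρ (⊥E d)     = ⊥E (rename ρ d)
rename ρ (∧I d e)   = ∧I (rename ρ d) (rename ρ e)
rename ρ (∧E₁ d)    = ∧E₁ (rename ρ d)
rename ρ (∧E₂ d)    = ∧E₂ (rename ρ d)
rename ρ (∨I₁ d)    = ∨I₁ (rename ρ d)
rename ρ (∨I₂ d)    = ∨I₂ (rename ρ d)
rename ρ (∨E d e f) = ∨E (rename ρ d) (rename (lift-renaming ρ) e) (rename (lift-renaming ρ) f)
rename ρ (⊃I d)     = ⊃I (rename (lift-renaming ρ) d)
rename ρ (⊃E d e)   = ⊃E (rename ρ d) (rename ρ e)

weaken : ∀ {Γ A C} → Γ ⊢ C → (A ∷ Γ) ⊢ C
weaken = rename there

Substitution : List Fm → List Fm → Set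
Substitution Γ Δ = ∀ {X} → X ∈ Γ → Δ ⊢ X

lift-substitution : ∀ {Γ Δ A} → Substitution Γ Δ → Substitution (A ∷ Γ) (A ∷ Δ)
lift-substitution σ (here refl) = hyp (here refl)
lift-substitution σ (there p)   = weaken (σ p)

substitute : ∀ {Γ Δ C} → Substitution Γ Δ → Γ ⊢ C → Δ ⊢ C
substitute σ (hyp x)    = σ x
substitute σ (⊥E d)     = ⊥E (substitute σ d)
substitute σ (∧I d e)   = ∧I (substitute σ d) (substitute σ e)
substitute σ (∧E₁ d)    = ∧E₁ (substitute σ d)
substitute σ (∧E₂ d)    = ∧E₂ (substitute σ d)
substitute σ (∨I₁ d)    = ∨I₁ (substitute σ d)
substitute σ (∨I₂ d)    = ∨I₂ (substitute σ d)
substitute σ (∨E d e f) = ∨E (substitute σ d) (substitute (lift-substitution σ) e) (substitute (lift-substitution σ) f)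
substitute σ (⊃I d)     = ⊃I (substitute (lift-substitution σ) d)
substitute σ (⊃E d e)   = ⊃E (substitute σ d) (substitute σ e)

replace-head : ∀ {Γ A B C} → (B ∷ Γ) ⊢ A → (A ∷ Γ) ⊢ C → (B ∷ Γ) ⊢ C
replace-head {Γ} {A} {B} d = substitute σ
  where
  σ : Substitution (A ∷ Γ) (B ∷ Γ)
  σ (here refl) = d
  σ (there p)   = hyp (there p)

split-∧-head : ∀ {Γ A B C} → (A ∷ B ∷ Γ) ⊢ C → ((A ∧ B) ∷ Γ) ⊢ C
split-∧-head {Γ} {A} {B} = substitute σ
  where
  σ : Substitution (A ∷ B ∷ Γ) ((A ∧ B) ∷ Γ)
  σ (here refl)         = ∧E₁ (hyp (here refl))
  σ (there (here refl)) = ∧E₂ (hyp (here refl))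
  σ (there (there p))   = hyp (there p)

GBU⇒NJ : ∀ {G k Ψ A} → GBU G k Ψ A → Ψ ⊢ A
GBU⇒NJ (set-eq Φ≈Ψ _ d) = rename (λ {X} → Equivalence.to (Φ≈Ψ X)) (GBU⇒NJ d)
GBU⇒NJ (ax-reg _)       = hyp (here refl)
GBU⇒NJ (ax-⊥ _)         = ⊥E (hyp (here refl))
GBU⇒NJ (ax-irr _)       = hyp (here refl)
GBU⇒NJ (L∧ _ d)         = split-∧-head (GBU⇒NJ d)
GBU⇒NJ (R∧ _ d e)       = ∧I (GBU⇒NJ d) (GBU⇒NJ e)
GBU⇒NJ (L∨ _ d e)       = ∨E (hyp (here refl))
                             (rename (lift-renaming there) (GBU⇒NJ d))
                             (rename (lift-renaming there) (GBU⇒NJ e))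
GBU⇒NJ (R∨₁ _ d)        = ∨I₁ (GBU⇒NJ d)
GBU⇒NJ (R∨₂ _ d)        = ∨I₂ (GBU⇒NJ d)
GBU⇒NJ (L⊃ _ d e)       = replace-head (⊃E (hyp (here refl)) (GBU⇒NJ d)) (GBU⇒NJ e)
GBU⇒NJ (⊃R∈ _ _ d)      = ⊃I (weaken (GBU⇒NJ d))
GBU⇒NJ (⊃R∉ _ _ d)      = ⊃I (GBU⇒NJ d)

⋀-elim : ∀ Ψ → Substitution Ψ (⋀ Ψ ∷ [])
⋀-elim (A ∷ [])     (here refl) = hyp (here refl)
⋀-elim (A ∷ B ∷ Ψ)  (here refl) = ∧E₁ (hyp (here refl))
⋀-elim (A ∷ B ∷ Ψ)  (there p)   = replace-head (∧E₂ (hyp (here refl))) (⋀-elim (B ∷ Ψ) p)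

lemma5p1 : ∀ (G : Fm) (k : Arrow) (Ψ : List Fm) (A : Fm) →
    GBU G k Ψ A → Valid (⋀ Ψ ⊃ A)
lemma5p1 G k Ψ A d = ⊃I (substitute (⋀-elim Ψ) (GBU⇒NJ d))
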